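{- For all integers $m\ge 0$ and $n\ge 1$, writing $U_k=T_{k}^{(s_{1,0}^{(n)},s_{1,1}^{(n)},s_{1,2}^{(n)})}$, \begin{align*} \frac{1}{(A_1^{(n)})^3}\sum_{\substack{k_1+k_2+k_3=m\\ k_1,k_2,k_3\ge 0}}\binom{m}{k_1,k_2,k_3}U_{k_1}U_{k_2}U_{k_3} &=-\frac{2}{A_1^{(3n)}}3^m T_{m}^{(s_{1,0}^{(3n)},s_{1,1}^{(3n)},s_{1,2}^{(3n)})}+\frac{6}{44^n}\\ &\quad+\frac{3}{A_1^{(2n)}A_1^{(n)}}\sum_{k=0}^m\binom{m}{k}2^{k}T_{k}^{(s_{1,0}^{(2n)},s_{1,1}^{(2n)},s_{1,2}^{(2n)})}U_{m-k}. \end{align*}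
   Context: Let $\alpha,\beta,\gamma$ be the three distinct complex roots of $x^3-x^2-x-1=0$, and set $c_1=\frac{\alpha}{(\alpha-\beta)(\alpha-\gamma)}$, $c_2=\frac{\beta}{(\beta-\alpha)(\beta-\gamma)}$, $c_3=\frac{\gamma}{(\gamma-\alpha)(\gamma-\beta)}$. For numbers $s_0,s_1,s_2$, the sequence $T_k^{(s_0,s_1,s_2)}$ is defined by $T_0^{(s_0,s_1,s_2)}=s_0$, $T_1^{(s_0,s_1,s_2)}=s_1$, $T_2^{(s_0,s_1,s_2)}=s_2$ and $T_k^{(s_0,s_1,s_2)}=T_{k-1}^{(s_0,s_1,s_2)}+T_{k-2}^{(s_0,s_1,s_2)}+T_{k-3}^{(s_0,s_1,s_2)}$ for $k\ge3$. For each integer $N\ge1$, let $A_1^{(N)}\neq0$ and $s_{1,0}^{(N)},s_{1,1}^{(N)},s_{1,2}^{(N)}$ be numbers such that $c_1^Ne^{\alpha x}+c_2^Ne^{\beta x}+c_3^Ne^{\gamma x}=\frac{1}{A_1^{(N)}}\sum_{k\ge0}T_k^{(s_{1,0}^{(N)},s_{1,1}^{(N)},s_{1,2}^{(N)})}\frac{x^k}{k!}$ (in the paper these are specific integer normalizations). $\binom{m}{k_1,\dots,k_r}=\frac{m!}{k_1!\cdots k_r!}$ is the multinomial coefficient. -}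

module Defs where

open import Level using (Level)
open import Data.Nat as ℕ using (ℕ; zero; suc; _∸_; _!)
open import Data.Nat.Properties using (_!≢0; _!*_!≢0; m*n≢0)
open import Algebra.Bundles using (CommutativeRing)

multinomial3 : ℕ → ℕ → ℕ → ℕ → ℕ
multinomial3 m k₁ k₂ k₃ =
  ℕ._/_ (m !) ((k₁ ! ℕ.* k₂ !) ℕ.* k₃ !)
    {{m*n≢0 (k₁ ! ℕ.* k₂ !) (k₃ !) {{k₁ !* k₂ !≢0}} {{k₃ !≢0}}}}

module Ring {c ℓ : Level} (R : CommutativeRing c ℓ) where
  open CommutativeRing R hiding (zero)

  ι : ℕ → Carrier
  ι zero    = 0#
  ι (suc n) = 1# + ι n

  pow : Carrier → ℕ → Carrier
  pow x zero    = 1#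
  pow x (suc n) = x * pow x n

  T : Carrier → Carrier → Carrier → ℕ → Carrier
  T s₀ s₁ s₂ zero                = s₀
  T s₀ s₁ s₂ (suc zero)          = s₁
  T s₀ s₁ s₂ (suc (suc zero))    = s₂
  T s₀ s₁ s₂ (suc (suc (suc k))) =
    T s₀ s₁ s₂ (suc (suc k)) + T s₀ s₁ s₂ (suc k) + T s₀ s₁ s₂ k

  sumTo : ℕ → (ℕ → Carrier) → Carrier
  sumTo zero    f = f zero
  sumTo (suc n) f = sumTo n f + f (suc n)

  sumTriples : ℕ → (ℕ → ℕ → ℕ → Carrier) → Carrier
  sumTriples m f = sumTo m (λ k₁ → sumTo (m ∸ k₁) (λ k₂ → f k₁ k₂ ((m ∸ k₁) ∸ k₂)))

{-# OPTIONS --safe #-}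
-- Binomial convolution (f ⋆ g) m = Σₖ C(m,k) f k g (m − k) is the product of exponential generating
-- functions, so the multinomial sum on the left is the m-th coefficient of the cube of the generating
-- function of U.  By hypothesis A₁^{(n)}⁻¹ U has generating function y₁ + y₂ + y₃ with yᵢ = cᵢⁿ e^{αᵢ t},
-- and the identity
--   (y₁ + y₂ + y₃)³ = 3 (y₁² + y₂² + y₃²)(y₁ + y₂ + y₃) − 2 (y₁³ + y₂³ + y₃³) + 6 y₁y₂y₃
-- gives the claim: Σ yᵢ² and Σ yᵢ³ are the generating functions of 2ᵏ A₁^{(2n)}⁻¹ T_k^{(2n)} and
-- 3ᵏ A₁^{(3n)}⁻¹ T_k^{(3n)}, while y₁y₂y₃ = (c₁c₂c₃)ⁿ e^{(α+β+γ) t} with α + β + γ = 1 and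
-- c₁c₂c₃ = αβγ / Π_{i≠j}(αᵢ − αⱼ) = 1/44, the product of the differences being minus the
-- discriminant −44 of x³ − x² − x − 1.  Generating functions of the form Σ pᵢ e^{xᵢ t} are modelled by
-- finite lists of pairs (pᵢ , xᵢ); up to equality of coefficients these form a commutative ring.
module Submission where

open import Defs
open import Level using (Level)
open import Algebra.Bundles using (CommutativeRing; RawRing)
open import Data.Nat as ℕ using (ℕ; zero; suc; _≥_; _∸_; _≤_; z≤n; _!)
open import Data.Nat.Combinatorics using (_C_; nCk≡n!/k![n-k]!; k![n∸k]!∣n!)
open import Data.Fin using (toℕ)
open import Data.Product using (_×_; _,_; proj₁; proj₂)
open import Data.List using (List; []; _∷_; _++_; map)
open import Data.List.Properties using (map-++; ++-assoc; ++-identityʳ)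
open import Data.Maybe using (Maybe; just; nothing)
open import Relation.Binary.PropositionalEquality as ≡ using (_≡_)
open import Relation.Nullary using (yes; no)

module RingLemmas {c ℓ : Level} (R : CommutativeRing c ℓ) where
  open CommutativeRing R
  open Ring R
  open import Relation.Binary.Reasoning.Setoid setoid
  open import Algebra.Properties.CommutativeSemigroup *-commutativeSemigroup
    using () renaming (interchange to *-interchange)

  ι-homo-+ : ∀ m n → ι (m ℕ.+ n) ≈ ι m + ι n
  ι-homo-+ zero    n = sym (+-identityˡ _)
  ι-homo-+ (suc m) n = trans (+-congˡ (ι-homo-+ m n)) (sym (+-assoc _ _ _))

  ι-homo-* : ∀ m n → ι (m ℕ.* n) ≈ ι m * ι n
  ι-homo-* zero    n = sym (zeroˡ _)
  ι-homo-* (suc m) n = begin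
    ι (n ℕ.+ m ℕ.* n)        ≈⟨ ι-homo-+ n (m ℕ.* n) ⟩
    ι n + ι (m ℕ.* n)        ≈⟨ +-cong (sym (*-identityˡ _)) (ι-homo-* m n) ⟩
    1# * ι n + ι m * ι n     ≈⟨ distribʳ _ _ _ ⟨
    (1# + ι m) * ι n         ∎

  pow-cong : ∀ {x y} → x ≈ y → ∀ k → pow x k ≈ pow y k
  pow-cong x≈y zero    = refl
  pow-cong x≈y (suc k) = *-cong x≈y (pow-cong x≈y k)

  pow-homo-+ : ∀ x m n → pow x (m ℕ.+ n) ≈ pow x m * pow x n
  pow-homo-+ x zero    n = sym (*-identityˡ _)
  pow-homo-+ x (suc m) n = trans (*-congˡ (pow-homo-+ x m n)) (sym (*-assoc _ _ _))

  pow-distrib-* : ∀ x y k → pow (x * y) k ≈ pow x k * pow y k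
  pow-distrib-* x y zero    = sym (*-identityˡ _)
  pow-distrib-* x y (suc k) = trans (*-congˡ (pow-distrib-* x y k)) (*-interchange _ _ _ _)

  pow-2* : ∀ x n → pow x (2 ℕ.* n) ≈ pow x n * pow x n
  pow-2* x n = trans (pow-homo-+ x n (1 ℕ.* n))
                     (*-congˡ (trans (pow-homo-+ x n 0) (*-identityʳ _)))

  pow-3* : ∀ x n → pow x (3 ℕ.* n) ≈ pow x n * (pow x n * pow x n)
  pow-3* x n = trans (pow-homo-+ x n (2 ℕ.* n)) (*-congˡ (pow-2* x n))

  pow-1# : ∀ k → pow 1# k ≈ 1#
  pow-1# zero    = refl
  pow-1# (suc k) = trans (*-identityˡ _) (pow-1# k)

module IntegerCoefficientSolver {c ℓ : Level} (R : CommutativeRing c ℓ) where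
  open CommutativeRing R
  open Ring R
  open RingLemmas R
  open import Relation.Binary.Reasoning.Setoid setoid
  open import Algebra.Properties.Ring ring using (-‿distribˡ-*; -‿distribʳ-*; -‿involutive; -0#≈0#)
  open import Algebra.Properties.AbelianGroup +-abelianGroup using (⁻¹-∙-comm; ⁻¹-anti-homo‿-)
  open import Algebra.Properties.CommutativeSemigroup +-commutativeSemigroup using (interchange)
  open import Algebra.Solver.Ring.AlmostCommutativeRing
    using (_-Raw-AlmostCommutative⟶_; fromCommutativeRing)
  open import Data.Nat.Properties using (+-suc)

  -- The pair (a , b) stands for the integer a − b; (n , 0) denotes ι n on the nose.
  difference : ℕ × ℕ → Carrier
  difference (a , zero)  = ι a
  difference (a , suc b) = difference (a , b) - 1#

  difference≈ι-ι : ∀ a b → difference (a , b) ≈ ι a - ι b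
  difference≈ι-ι a zero    = sym (trans (+-congˡ -0#≈0#) (+-identityʳ _))
  difference≈ι-ι a (suc b) = begin
    difference (a , b) - 1#  ≈⟨ +-congʳ (difference≈ι-ι a b) ⟩
    (ι a - ι b) - 1#         ≈⟨ +-assoc _ _ _ ⟩
    ι a + (- ι b - 1#)       ≈⟨ +-congˡ (⁻¹-∙-comm (ι b) 1#) ⟩
    ι a - (ι b + 1#)         ≈⟨ +-congˡ (-‿cong (+-comm _ _)) ⟩
    ι a - (1# + ι b)         ∎

  -‿interchange : ∀ x y z w → (x + z) - (y + w) ≈ (x - y) + (z - w)
  -‿interchange x y z w = trans (+-congˡ (sym (⁻¹-∙-comm y w))) (interchange x z (- y) (- w))

  -‿*-expand : ∀ x y z w → (x * z + y * w) - (x * w + y * z) ≈ (x - y) * (z - w)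
  -‿*-expand x y z w = sym (begin
    (x - y) * (z - w)                                   ≈⟨ distribʳ _ _ _ ⟩
    x * (z - w) + - y * (z - w)                         ≈⟨ +-cong (distribˡ _ _ _) (distribˡ _ _ _) ⟩
    (x * z + x * - w) + (- y * z + - y * - w)
      ≈⟨ +-cong (+-congˡ (sym (-‿distribʳ-* x w)))
                (+-cong (sym (-‿distribˡ-* y z)) (trans (sym (-‿distribˡ-* y (- w)))
                  (trans (-‿cong (sym (-‿distribʳ-* y w))) (-‿involutive _)))) ⟩
    (x * z - x * w) + (- (y * z) + y * w)               ≈⟨ +-congˡ (+-comm _ _) ⟩
    (x * z - x * w) + (y * w - y * z)                   ≈⟨ interchange _ _ _ _ ⟩
    (x * z + y * w) + (- (x * w) + - (y * z))           ≈⟨ +-congˡ (⁻¹-∙-comm _ _) ⟩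
    (x * z + y * w) - (x * w + y * z)                   ∎)

  -‿balance : ∀ {x y z w} → x + w ≈ z + y → x - y ≈ z - w
  -‿balance {x} {y} {z} {w} x+w≈z+y = begin
    x - y                    ≈⟨ +-identityʳ _ ⟨
    (x - y) + 0#             ≈⟨ +-congˡ (-‿inverseʳ w) ⟨
    (x - y) + (w - w)        ≈⟨ -‿interchange x y w w ⟨
    (x + w) - (y + w)        ≈⟨ +-cong x+w≈z+y (-‿cong (+-comm y w)) ⟩
    (z + y) - (w + y)        ≈⟨ -‿interchange z w y y ⟩
    (z - w) + (y - y)        ≈⟨ +-congˡ (-‿inverseʳ y) ⟩
    (z - w) + 0#             ≈⟨ +-identityʳ _ ⟩
    z - w                    ∎

  -- Coefficients must be kept canonical: the solver compares normal forms syntactically.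
  reduce : ℕ → ℕ → ℕ × ℕ
  reduce a b = (a ∸ b , b ∸ a)

  ∸-balance : ∀ a b → (a ∸ b) ℕ.+ b ≡ a ℕ.+ (b ∸ a)
  ∸-balance zero    zero    = ≡.refl
  ∸-balance zero    (suc b) = ≡.refl
  ∸-balance (suc a) zero    = ≡.refl
  ∸-balance (suc a) (suc b) = ≡.trans (+-suc (a ∸ b) b) (≡.cong suc (∸-balance a b))

  difference-reduce : ∀ a b → difference (reduce a b) ≈ ι a - ι b
  difference-reduce a b = begin
    difference (reduce a b)   ≈⟨ difference≈ι-ι (a ∸ b) (b ∸ a) ⟩
    ι (a ∸ b) - ι (b ∸ a)     ≈⟨ -‿balance (trans (sym (ι-homo-+ (a ∸ b) b))
                                   (trans (reflexive (≡.cong ι (∸-balance a b))) (ι-homo-+ a (b ∸ a)))) ⟩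
    ι a - ι b                 ∎

  differences : RawRing _ _
  differences = record
    { Carrier = ℕ × ℕ
    ; _≈_     = _≡_
    ; _+_     = λ { (a , b) (c , d) → reduce (a ℕ.+ c) (b ℕ.+ d) }
    ; _*_     = λ { (a , b) (c , d) → reduce (a ℕ.* c ℕ.+ b ℕ.* d) (a ℕ.* d ℕ.+ b ℕ.* c) }
    ; -_      = λ { (a , b) → (b , a) }
    ; 0#      = (0 , 0)
    ; 1#      = (1 , 0)
    }

  homomorphism : differences -Raw-AlmostCommutative⟶ fromCommutativeRing R
  homomorphism = record
    { ⟦_⟧    = difference
    ; +-homo = λ { (a , b) (c , d) → begin
        difference (reduce (a ℕ.+ c) (b ℕ.+ d))  ≈⟨ difference-reduce (a ℕ.+ c) (b ℕ.+ d) ⟩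
        ι (a ℕ.+ c) - ι (b ℕ.+ d)                ≈⟨ +-cong (ι-homo-+ a c) (-‿cong (ι-homo-+ b d)) ⟩
        (ι a + ι c) - (ι b + ι d)                ≈⟨ -‿interchange _ _ _ _ ⟩
        (ι a - ι b) + (ι c - ι d)                ≈⟨ +-cong (difference≈ι-ι a b) (difference≈ι-ι c d) ⟨
        difference (a , b) + difference (c , d)  ∎ }
    ; *-homo = λ { (a , b) (c , d) → begin
        difference (reduce (a ℕ.* c ℕ.+ b ℕ.* d) (a ℕ.* d ℕ.+ b ℕ.* c))
          ≈⟨ difference-reduce (a ℕ.* c ℕ.+ b ℕ.* d) (a ℕ.* d ℕ.+ b ℕ.* c) ⟩
        ι (a ℕ.* c ℕ.+ b ℕ.* d) - ι (a ℕ.* d ℕ.+ b ℕ.* c)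
          ≈⟨ +-cong (trans (ι-homo-+ (a ℕ.* c) (b ℕ.* d)) (+-cong (ι-homo-* a c) (ι-homo-* b d)))
                    (-‿cong (trans (ι-homo-+ (a ℕ.* d) (b ℕ.* c)) (+-cong (ι-homo-* a d) (ι-homo-* b c)))) ⟩
        (ι a * ι c + ι b * ι d) - (ι a * ι d + ι b * ι c)       ≈⟨ -‿*-expand (ι a) (ι b) (ι c) (ι d) ⟩
        (ι a - ι b) * (ι c - ι d)                               ≈⟨ *-cong (difference≈ι-ι a b) (difference≈ι-ι c d) ⟨
        difference (a , b) * difference (c , d)                 ∎ }
    ; -‿homo = λ { (a , b) → begin
        difference (b , a)     ≈⟨ difference≈ι-ι b a ⟩
        ι b - ι a              ≈⟨ ⁻¹-anti-homo‿- (ι a) (ι b) ⟨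
        - (ι a - ι b)          ≈⟨ -‿cong (difference≈ι-ι a b) ⟨
        - difference (a , b)   ∎ }
    ; 0-homo = refl
    ; 1-homo = +-identityʳ 1#
    }

  difference-≟ : ∀ p q → Maybe (difference p ≈ difference q)
  difference-≟ (a , b) (c , d) with a ℕ.+ d ℕ.≟ c ℕ.+ b
  ... | no  _ = nothing
  ... | yes e = just (begin
    difference (a , b)  ≈⟨ difference≈ι-ι a b ⟩
    ι a - ι b           ≈⟨ -‿balance (trans (sym (ι-homo-+ a d)) (trans (reflexive (≡.cong ι e)) (ι-homo-+ c b))) ⟩
    ι c - ι d           ≈⟨ difference≈ι-ι c d ⟨
    difference (c , d)  ∎)

  open import Algebra.Solver.Ring differences (fromCommutativeRing R) homomorphism difference-≟ public

module CubeOfSum {c ℓ : Level} (R : CommutativeRing c ℓ) where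
  open CommutativeRing R
  open Ring R
  open IntegerCoefficientSolver R

  cube-of-sum : ∀ x y z →
    (x + y + z) * ((x + y + z) * (x + y + z))
      ≈ - (ι 2 * (x * (x * x) + y * (y * y) + z * (z * z)))
        + ι 6 * (x * (y * z))
        + ι 3 * ((x * x + y * y + z * z) * (x + y + z))
  cube-of-sum = solve 3 (λ x y z →
    (x :+ y :+ z) :* ((x :+ y :+ z) :* (x :+ y :+ z))
      := :- (con (2 , 0) :* (x :* (x :* x) :+ y :* (y :* y) :+ z :* (z :* z)))
         :+ con (6 , 0) :* (x :* (y :* z))
         :+ con (3 , 0) :* ((x :* x :+ y :* y :+ z :* z) :* (x :+ y :+ z))) refl

module Vieta {c ℓ : Level} (R : CommutativeRing c ℓ) where
  open CommutativeRing R
  open Ring R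
  open IntegerCoefficientSolver R
  open import Relation.Binary.Reasoning.Setoid setoid
  open import Algebra.Properties.Group +-group using (x≈y⇒x∙y⁻¹≈ε; x∙y⁻¹≈ε⇒x≈y; inverseˡ-unique; ⁻¹-involutive)

  unit-cancel : ∀ {u v t} → u * v ≈ 1# → u * t ≈ 0# → t ≈ 0#
  unit-cancel {u} {v} {t} uv≈1 ut≈0 = begin
    t                ≈⟨ *-identityʳ t ⟨
    t * 1#           ≈⟨ *-congˡ uv≈1 ⟨
    t * (u * v)      ≈⟨ solve 3 (λ u v t → t :* (u :* v) := (u :* t) :* v) refl u v t ⟩
    (u * t) * v      ≈⟨ *-congʳ ut≈0 ⟩
    0# * v           ≈⟨ zeroˡ v ⟩
    0#               ∎

  unit-factorˡ : ∀ {x y d} → (x * y) * d ≈ 1# → x * (y * d) ≈ 1#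
  unit-factorˡ xyd≈1 = trans (sym (*-assoc _ _ _)) xyd≈1

  unit-factorʳ : ∀ {x y d} → (x * y) * d ≈ 1# → y * (x * d) ≈ 1#
  unit-factorʳ {x} {y} {d} xyd≈1 =
    trans (solve 3 (λ x y d → y :* (x :* d) := (x :* y) :* d) refl x y d) xyd≈1

  -- the discriminant of x³ − s x² − t x − u, so e₂ enters as −t
  discriminant : Carrier → Carrier → Carrier → Carrier
  discriminant s t u =
    s * s * t * t + ι 4 * (t * t * t) - ι 4 * (s * s * s * u) - ι 18 * (s * t * u) - ι 27 * (u * u)

  discriminant-cong : ∀ {s s′ t t′ u u′} → s ≈ s′ → t ≈ t′ → u ≈ u′ →
                      discriminant s t u ≈ discriminant s′ t′ u′
  discriminant-cong s≈ t≈ u≈ =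
    +-cong (+-cong (+-cong (+-cong (*-cong (*-cong (*-cong s≈ s≈) t≈) t≈)
                                   (*-congˡ (*-cong (*-cong t≈ t≈) t≈)))
                           (-‿cong (*-congˡ (*-cong (*-cong (*-cong s≈ s≈) s≈) u≈))))
                   (-‿cong (*-congˡ (*-cong (*-cong s≈ t≈) u≈))))
           (-‿cong (*-congˡ (*-cong u≈ u≈)))

  module DistinctRoots {s t u α β γ : Carrier}
    (root-α : pow α 3 ≈ s * pow α 2 + t * α + u)
    (root-β : pow β 3 ≈ s * pow β 2 + t * β + u)
    (root-γ : pow γ 3 ≈ s * pow γ 2 + t * γ + u)
    {dαβ dαγ dβγ : Carrier}
    (unit-αβ : (α - β) * dαβ ≈ 1#)
    (unit-αγ : (α - γ) * dαγ ≈ 1#)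
    (unit-βγ : (β - γ) * dβγ ≈ 1#)
    where

    private
      f : Carrier → Carrier
      f x = pow x 3 - (s * pow x 2 + t * x + u)

      Q : Carrier → Carrier → Carrier
      Q x y = x * x + x * y + y * y - s * (x + y) - t

      Q-divided-difference : ∀ x y → (x - y) * Q x y ≈ f x - f y
      Q-divided-difference x y = solve 5 (λ x y s t u →
        (x :- y) :* (x :* x :+ x :* y :+ y :* y :- s :* (x :+ y) :- t)
          := (x :^ 3 :- (s :* x :^ 2 :+ t :* x :+ u)) :- (y :^ 3 :- (s :* y :^ 2 :+ t :* y :+ u)))
        refl x y s t u

      Q-difference : ∀ x y z → (y - z) * (x + y + z - s) ≈ Q x y - Q x z
      Q-difference x y z = solve 5 (λ x y z s t →
        (y :- z) :* (x :+ y :+ z :- s)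
          := (x :* x :+ x :* y :+ y :* y :- s :* (x :+ y) :- t)
             :- (x :* x :+ x :* z :+ z :* z :- s :* (x :+ z) :- t))
        refl x y z s t

      e₂-identity : ∀ x y z → x * y + y * z + z * x + t ≈ - Q x y + (x + y + z - s) * (x + y)
      e₂-identity x y z = solve 5 (λ x y z s t →
        x :* y :+ y :* z :+ z :* x :+ t
          := :- (x :* x :+ x :* y :+ y :* y :- s :* (x :+ y) :- t) :+ (x :+ y :+ z :- s) :* (x :+ y))
        refl x y z s t

      e₃-identity : ∀ x y z → x * y * z - u
                    ≈ f x - (x + y + z - s) * (x * x) + (x * y + y * z + z * x + t) * x
      e₃-identity x y z = solve 6 (λ x y z s t u →
        x :* y :* z :- u
          := (x :^ 3 :- (s :* x :^ 2 :+ t :* x :+ u)) :- (x :+ y :+ z :- s) :* (x :* x)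
             :+ (x :* y :+ y :* z :+ z :* x :+ t) :* x)
        refl x y z s t u

      f-root : ∀ {x} → pow x 3 ≈ s * pow x 2 + t * x + u → f x ≈ 0#
      f-root = x≈y⇒x∙y⁻¹≈ε

      0-0≈0 : 0# - 0# ≈ 0#
      0-0≈0 = -‿inverseʳ 0#

      Q-root : ∀ {x y d} → pow x 3 ≈ s * pow x 2 + t * x + u → pow y 3 ≈ s * pow y 2 + t * y + u →
               (x - y) * d ≈ 1# → Q x y ≈ 0#
      Q-root {x} {y} root-x root-y unit = unit-cancel unit (begin
        (x - y) * Q x y  ≈⟨ Q-divided-difference x y ⟩
        f x - f y        ≈⟨ +-cong (f-root root-x) (-‿cong (f-root root-y)) ⟩
        0# - 0#          ≈⟨ 0-0≈0 ⟩
        0#               ∎)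

      e₁-gap : α + β + γ - s ≈ 0#
      e₁-gap = unit-cancel unit-βγ (begin
        (β - γ) * (α + β + γ - s)  ≈⟨ Q-difference α β γ ⟩
        Q α β - Q α γ              ≈⟨ +-cong (Q-root root-α root-β unit-αβ) (-‿cong (Q-root root-α root-γ unit-αγ)) ⟩
        0# - 0#                    ≈⟨ 0-0≈0 ⟩
        0#                         ∎)

      e₂-gap : α * β + β * γ + γ * α + t ≈ 0#
      e₂-gap = begin
        α * β + β * γ + γ * α + t            ≈⟨ e₂-identity α β γ ⟩
        - Q α β + (α + β + γ - s) * (α + β)  ≈⟨ +-cong (-‿cong (Q-root root-α root-β unit-αβ)) (*-congʳ e₁-gap) ⟩
        - 0# + 0# * (α + β)                  ≈⟨ solve 1 (λ x → :- con (0 , 0) :+ con (0 , 0) :* x := con (0 , 0)) refl _ ⟩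
        0#                                   ∎

    vieta-sum : α + β + γ ≈ s
    vieta-sum = x∙y⁻¹≈ε⇒x≈y _ _ e₁-gap

    vieta-pair : α * β + β * γ + γ * α ≈ - t
    vieta-pair = inverseˡ-unique _ _ e₂-gap

    vieta-product : α * β * γ ≈ u
    vieta-product = x∙y⁻¹≈ε⇒x≈y _ _ (begin
      α * β * γ - u
        ≈⟨ e₃-identity α β γ ⟩
      f α - (α + β + γ - s) * (α * α) + (α * β + β * γ + γ * α + t) * α
        ≈⟨ +-cong (+-cong (f-root root-α) (-‿cong (*-congʳ e₁-gap))) (*-congʳ e₂-gap) ⟩
      0# - 0# * (α * α) + 0# * α
        ≈⟨ solve 1 (λ x → con (0 , 0) :- con (0 , 0) :* (x :* x) :+ con (0 , 0) :* x := con (0 , 0)) refl α ⟩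
      0# ∎)

    differences-product : ((α - β) * (α - γ)) * (((β - α) * (β - γ)) * ((γ - α) * (γ - β)))
                          ≈ - discriminant s t u
    differences-product = begin
      ((α - β) * (α - γ)) * (((β - α) * (β - γ)) * ((γ - α) * (γ - β)))
        ≈⟨ solve 3 (λ α β γ →
             ((α :- β) :* (α :- γ)) :* (((β :- α) :* (β :- γ)) :* ((γ :- α) :* (γ :- β)))
               := :- (let e₁ = α :+ β :+ γ ; e₂ = :- (α :* β :+ β :* γ :+ γ :* α) ; e₃ = α :* β :* γ in
                      e₁ :* e₁ :* e₂ :* e₂ :+ con (4 , 0) :* (e₂ :* e₂ :* e₂) :- con (4 , 0) :* (e₁ :* e₁ :* e₁ :* e₃)
                        :- con (18 , 0) :* (e₁ :* e₂ :* e₃) :- con (27 , 0) :* (e₃ :* e₃)))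
           refl α β γ ⟩
      - discriminant (α + β + γ) (- (α * β + β * γ + γ * α)) (α * β * γ)
        ≈⟨ -‿cong (discriminant-cong vieta-sum (trans (-‿cong vieta-pair) (⁻¹-involutive t)) vieta-product) ⟩
      - discriminant s t u ∎

module Multinomial where
  open import Data.Nat.Properties using (_!≢0; _!*_!≢0; m*n≢0)
  open import Data.Nat.DivMod using (m/n*n≡m; m*n/n≡m; /-congˡ)
  open ≡.≡-Reasoning
  open import Data.Nat using (_*_)

  C*factorials : ∀ {n k} → k ≤ n → (n C k) * (k ! * (n ∸ k) !) ≡ n !
  C*factorials {n} {k} k≤n = ≡.trans (≡.cong (_* (k ! * (n ∸ k) !)) (nCk≡n!/k![n-k]! k≤n))
                                     (m/n*n≡m (k![n∸k]!∣n! k≤n))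
    where instance _ = k !* (n ∸ k) !≢0

  multinomial3≡C*C : ∀ m k₁ k₂ → k₁ ≤ m → k₂ ≤ m ∸ k₁ →
    multinomial3 m k₁ k₂ ((m ∸ k₁) ∸ k₂) ≡ (m C k₁) * ((m ∸ k₁) C k₂)
  multinomial3≡C*C m k₁ k₂ k₁≤m k₂≤m∸k₁ =
    ≡.trans (/-congˡ (≡.sym product≡m!)) (m*n/n≡m ((m C k₁) * ((m ∸ k₁) C k₂)) ((k₁ ! * k₂ !) * k₃ !))
    where
    open import Data.Nat.Tactic.RingSolver using (solve-∀)
    k₃ : ℕ
    k₃ = (m ∸ k₁) ∸ k₂
    instance _ = m*n≢0 (k₁ ! * k₂ !) (k₃ !) {{k₁ !* k₂ !≢0}} {{k₃ !≢0}}
    rearrange : ∀ a b x y z → (a * b) * ((x * y) * z) ≡ a * (x * (b * (y * z)))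
    rearrange = solve-∀
    product≡m! : ((m C k₁) * ((m ∸ k₁) C k₂)) * ((k₁ ! * k₂ !) * k₃ !) ≡ m !
    product≡m! = begin
      ((m C k₁) * ((m ∸ k₁) C k₂)) * ((k₁ ! * k₂ !) * k₃ !)
        ≡⟨ rearrange (m C k₁) ((m ∸ k₁) C k₂) (k₁ !) (k₂ !) (k₃ !) ⟩
      (m C k₁) * (k₁ ! * (((m ∸ k₁) C k₂) * (k₂ ! * k₃ !)))
        ≡⟨ ≡.cong (λ x → (m C k₁) * (k₁ ! * x)) (C*factorials k₂≤m∸k₁) ⟩
      (m C k₁) * (k₁ ! * (m ∸ k₁) !)
        ≡⟨ C*factorials k₁≤m ⟩
      m ! ∎

module BinomialConvolution {c ℓ : Level} (R : CommutativeRing c ℓ) where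
  open CommutativeRing R
  open Ring R
  open RingLemmas R
  open IntegerCoefficientSolver R using (solve; _:=_; _:*_; _:+_; _:^_)
  open import Relation.Binary.Reasoning.Setoid setoid
  open import Data.Nat.Properties using (≤-refl; m≤n⇒m≤1+n)
  open import Algebra.Properties.CommutativeSemigroup +-commutativeSemigroup using (interchange)

  sumTo-cong : ∀ n {f g : ℕ → Carrier} → (∀ k → k ≤ n → f k ≈ g k) → sumTo n f ≈ sumTo n g
  sumTo-cong zero    f≈g = f≈g 0 z≤n
  sumTo-cong (suc n) f≈g = +-cong (sumTo-cong n (λ k k≤n → f≈g k (m≤n⇒m≤1+n k≤n))) (f≈g (suc n) ≤-refl)

  sumTo-distrib-+ : ∀ n (f g : ℕ → Carrier) → sumTo n (λ k → f k + g k) ≈ sumTo n f + sumTo n g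
  sumTo-distrib-+ zero    f g = refl
  sumTo-distrib-+ (suc n) f g = trans (+-congʳ (sumTo-distrib-+ n f g)) (interchange _ _ _ _)

  *-distribˡ-sumTo : ∀ n x (f : ℕ → Carrier) → x * sumTo n f ≈ sumTo n (λ k → x * f k)
  *-distribˡ-sumTo zero    x f = refl
  *-distribˡ-sumTo (suc n) x f = trans (distribˡ _ _ _) (+-congʳ (*-distribˡ-sumTo n x f))

  sumTo-0# : ∀ n → sumTo n (λ _ → 0#) ≈ 0#
  sumTo-0# zero    = refl
  sumTo-0# (suc n) = trans (+-identityʳ _) (sumTo-0# n)

  sumTo-suc : ∀ n (f : ℕ → Carrier) → sumTo (suc n) f ≈ f 0 + sumTo n (λ k → f (suc k))
  sumTo-suc zero    f = refl
  sumTo-suc (suc n) f = trans (+-congʳ (sumTo-suc n f)) (+-assoc _ _ _)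

  infixl 7 _⋆_

  _⋆_ : (ℕ → Carrier) → (ℕ → Carrier) → ℕ → Carrier
  (f ⋆ g) m = sumTo m (λ k → ι (m C k) * (f k * g (m ∸ k)))

  ⋆-cong : ∀ {f f′ g g′ : ℕ → Carrier} → (∀ k → f k ≈ f′ k) → (∀ k → g k ≈ g′ k) →
           ∀ m → (f ⋆ g) m ≈ (f′ ⋆ g′) m
  ⋆-cong f≈ g≈ m = sumTo-cong m (λ k _ → *-congˡ (*-cong (f≈ k) (g≈ (m ∸ k))))

  ⋆-zeroˡ : ∀ (g : ℕ → Carrier) m → ((λ _ → 0#) ⋆ g) m ≈ 0#
  ⋆-zeroˡ g m = trans (sumTo-cong m (λ k _ → trans (*-congˡ (zeroˡ _)) (zeroʳ _))) (sumTo-0# m)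

  ⋆-zeroʳ : ∀ (f : ℕ → Carrier) m → (f ⋆ (λ _ → 0#)) m ≈ 0#
  ⋆-zeroʳ f m = trans (sumTo-cong m (λ k _ → trans (*-congˡ (zeroʳ _)) (zeroʳ _))) (sumTo-0# m)

  ⋆-distribʳ-+ : ∀ (f f′ g : ℕ → Carrier) m → ((λ k → f k + f′ k) ⋆ g) m ≈ (f ⋆ g) m + (f′ ⋆ g) m
  ⋆-distribʳ-+ f f′ g m = trans (sumTo-cong m (λ k _ → expand _ _ _ _)) (sumTo-distrib-+ m _ _)
    where
    expand : ∀ i x x′ y → i * ((x + x′) * y) ≈ i * (x * y) + i * (x′ * y)
    expand = solve 4 (λ i x x′ y → i :* ((x :+ x′) :* y) := i :* (x :* y) :+ i :* (x′ :* y)) refl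

  ⋆-distribˡ-+ : ∀ (f g g′ : ℕ → Carrier) m → (f ⋆ (λ k → g k + g′ k)) m ≈ (f ⋆ g) m + (f ⋆ g′) m
  ⋆-distribˡ-+ f g g′ m = trans (sumTo-cong m (λ k _ → expand _ _ _ _)) (sumTo-distrib-+ m _ _)
    where
    expand : ∀ i x y y′ → i * (x * (y + y′)) ≈ i * (x * y) + i * (x * y′)
    expand = solve 4 (λ i x y y′ → i :* (x :* (y :+ y′)) := i :* (x :* y) :+ i :* (x :* y′)) refl

  ⋆-scaleˡ : ∀ a (f g : ℕ → Carrier) m → ((λ k → a * f k) ⋆ g) m ≈ a * (f ⋆ g) m
  ⋆-scaleˡ a f g m = trans (sumTo-cong m (λ k _ → swap _ _ _ _)) (sym (*-distribˡ-sumTo m a _))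
    where
    swap : ∀ i a x y → i * ((a * x) * y) ≈ a * (i * (x * y))
    swap = solve 4 (λ i a x y → i :* ((a :* x) :* y) := a :* (i :* (x :* y))) refl

  ⋆-scaleʳ : ∀ a (f g : ℕ → Carrier) m → (f ⋆ (λ k → a * g k)) m ≈ a * (f ⋆ g) m
  ⋆-scaleʳ a f g m = trans (sumTo-cong m (λ k _ → swap _ _ _ _)) (sym (*-distribˡ-sumTo m a _))
    where
    swap : ∀ i a x y → i * (x * (a * y)) ≈ a * (i * (x * y))
    swap = solve 4 (λ i a x y → i :* (x :* (a :* y)) := a :* (i :* (x :* y))) refl

  ⋆-pow : ∀ x y m → (pow x ⋆ pow y) m ≈ pow (x + y) m
  ⋆-pow x y m = sym (begin
    pow (x + y) m                    ≈⟨ pow≈^ (x + y) m ⟩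
    (x + y) ^ m                      ≈⟨ Binomial.theorem m x y ⟩
    Binomial.binomialExpansion x y m ≈⟨ sum≈sumTo m (λ k → (m C k) ×ᵣ (x ^ k * y ^ (m ∸ k))) ⟩
    sumTo m (λ k → (m C k) ×ᵣ (x ^ k * y ^ (m ∸ k)))
      ≈⟨ sumTo-cong m (λ k _ → trans (×≈ι* (m C k) _)
                                      (*-congˡ (sym (*-cong (pow≈^ x k) (pow≈^ y (m ∸ k)))))) ⟩
    (pow x ⋆ pow y) m                ∎)
    where
    open import Algebra.Properties.Semiring.Exp semiring using (_^_)
    open import Algebra.Definitions.RawMonoid +-rawMonoid using () renaming (_×_ to _×ᵣ_)
    open import Algebra.Properties.Monoid.Sum +-monoid using (sum)
    import Algebra.Properties.CommutativeSemiring.Binomial commutativeSemiring as Binomial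

    pow≈^ : ∀ x n → pow x n ≈ x ^ n
    pow≈^ x zero    = refl
    pow≈^ x (suc n) = *-congˡ (pow≈^ x n)

    ×≈ι* : ∀ n x → n ×ᵣ x ≈ ι n * x
    ×≈ι* zero    x = sym (zeroˡ x)
    ×≈ι* (suc n) x = trans (+-cong (sym (*-identityˡ x)) (×≈ι* n x)) (sym (distribʳ _ _ _))

    sum≈sumTo : ∀ n (f : ℕ → Carrier) → sum {suc n} (λ k → f (toℕ k)) ≈ sumTo n f
    sum≈sumTo zero    f = +-identityʳ _
    sum≈sumTo (suc n) f = trans (+-congˡ (sum≈sumTo n (λ k → f (suc k)))) (sym (sumTo-suc n f))

  multinomial-sum≈⋆ : ∀ (f g h : ℕ → Carrier) m →
    sumTriples m (λ k₁ k₂ k₃ → ι (multinomial3 m k₁ k₂ k₃) * (f k₁ * g k₂ * h k₃)) ≈ (f ⋆ (g ⋆ h)) m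
  multinomial-sum≈⋆ f g h m = sumTo-cong m inner
    where
    open Multinomial using (multinomial3≡C*C)
    regroup : ∀ i j x y z → (i * j) * (x * y * z) ≈ (i * x) * (j * (y * z))
    regroup = solve 5 (λ i j x y z → (i :* j) :* (x :* y :* z) := (i :* x) :* (j :* (y :* z))) refl
    inner : ∀ k₁ → k₁ ≤ m →
      sumTo (m ∸ k₁) (λ k₂ → ι (multinomial3 m k₁ k₂ ((m ∸ k₁) ∸ k₂)) * (f k₁ * g k₂ * h ((m ∸ k₁) ∸ k₂)))
        ≈ ι (m C k₁) * (f k₁ * (g ⋆ h) (m ∸ k₁))
    inner k₁ k₁≤m = begin
      sumTo (m ∸ k₁) (λ k₂ → ι (multinomial3 m k₁ k₂ ((m ∸ k₁) ∸ k₂)) * (f k₁ * g k₂ * h ((m ∸ k₁) ∸ k₂)))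
        ≈⟨ sumTo-cong (m ∸ k₁) (λ k₂ k₂≤ →
             trans (*-congʳ (trans (reflexive (≡.cong ι (multinomial3≡C*C m k₁ k₂ k₁≤m k₂≤)))
                                   (ι-homo-* (m C k₁) ((m ∸ k₁) C k₂))))
                   (regroup _ _ _ _ _)) ⟩
      sumTo (m ∸ k₁) (λ k₂ → (ι (m C k₁) * f k₁) * (ι ((m ∸ k₁) C k₂) * (g k₂ * h ((m ∸ k₁) ∸ k₂))))
        ≈⟨ *-distribˡ-sumTo (m ∸ k₁) _ _ ⟨
      (ι (m C k₁) * f k₁) * (g ⋆ h) (m ∸ k₁)
        ≈⟨ *-assoc _ _ _ ⟩
      ι (m C k₁) * (f k₁ * (g ⋆ h) (m ∸ k₁)) ∎

  ⋆-scale-cube : ∀ a (f : ℕ → Carrier) m →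
    ((λ k → a * f k) ⋆ ((λ k → a * f k) ⋆ (λ k → a * f k))) m ≈ pow a 3 * (f ⋆ (f ⋆ f)) m
  ⋆-scale-cube a f m = begin
    (af ⋆ (af ⋆ af)) m                             ≈⟨ ⋆-cong (λ _ → refl) inner m ⟩
    (af ⋆ (λ j → a * (a * (f ⋆ f) j))) m           ≈⟨ ⋆-scaleˡ a f (λ j → a * (a * (f ⋆ f) j)) m ⟩
    a * (f ⋆ (λ j → a * (a * (f ⋆ f) j))) m        ≈⟨ *-congˡ (⋆-scaleʳ a f (λ j → a * (f ⋆ f) j) m) ⟩
    a * (a * (f ⋆ (λ j → a * (f ⋆ f) j)) m)        ≈⟨ *-congˡ (*-congˡ (⋆-scaleʳ a f (f ⋆ f) m)) ⟩
    a * (a * (a * (f ⋆ (f ⋆ f)) m))                ≈⟨ solve 2 (λ a x → a :* (a :* (a :* x)) := a :^ 3 :* x) refl a _ ⟩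
    pow a 3 * (f ⋆ (f ⋆ f)) m                      ∎
    where
    af : ℕ → Carrier
    af k = a * f k
    inner : ∀ j → (af ⋆ af) j ≈ a * (a * (f ⋆ f) j)
    inner j = trans (⋆-scaleˡ a f af j) (*-congˡ (⋆-scaleʳ a f f j))

module ExponentialPolynomials {c ℓ : Level} (R : CommutativeRing c ℓ) where
  open CommutativeRing R
  open Ring R
  open RingLemmas R
  open BinomialConvolution R
  open import Relation.Binary.Reasoning.Setoid setoid
  open import Algebra.Properties.Ring ring using (-‿distribˡ-*)
  open import Algebra.Properties.AbelianGroup +-abelianGroup using (⁻¹-∙-comm)
  open import Algebra.Structures using (IsAbelianGroup)

  -- (p , x) is the sequence k ↦ p xᵏ, i.e. the exponential generating function p eˣᵗ.
  Term : Set c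
  Term = Carrier × Carrier

  ExpPoly : Set c
  ExpPoly = List Term

  ⟦_⟧ₜ : Term → ℕ → Carrier
  ⟦ p , x ⟧ₜ k = p * pow x k

  ⟦_⟧ : ExpPoly → ℕ → Carrier
  ⟦ []    ⟧ k = 0#
  ⟦ t ∷ f ⟧ k = ⟦ t ⟧ₜ k + ⟦ f ⟧ k

  infix 4 _≋_
  _≋_ : ExpPoly → ExpPoly → Set ℓ
  f ≋ g = ∀ k → ⟦ f ⟧ k ≈ ⟦ g ⟧ k

  infixl 7 _·_ _⊙_ _⊛_

  _·_ : Term → Term → Term
  (p , x) · (q , y) = (p * q , x + y)

  _⊙_ : Term → ExpPoly → ExpPoly
  t ⊙ g = map (t ·_) g

  _⊛_ : ExpPoly → ExpPoly → ExpPoly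
  []      ⊛ g = []
  (t ∷ f) ⊛ g = t ⊙ g ++ f ⊛ g

  ⊝_ : ExpPoly → ExpPoly
  ⊝ f = map (λ { (p , x) → (- p , x) }) f

  𝟙 : ExpPoly
  𝟙 = (1# , 0#) ∷ []

  ⟦⟧-homo-++ : ∀ f g k → ⟦ f ++ g ⟧ k ≈ ⟦ f ⟧ k + ⟦ g ⟧ k
  ⟦⟧-homo-++ []      g k = sym (+-identityˡ _)
  ⟦⟧-homo-++ (t ∷ f) g k = trans (+-congˡ (⟦⟧-homo-++ f g k)) (sym (+-assoc _ _ _))

  ⟦⟧-homo-⊝ : ∀ f k → ⟦ ⊝ f ⟧ k ≈ - ⟦ f ⟧ k
  ⟦⟧-homo-⊝ []            k = sym -0#≈0#
    where open import Algebra.Properties.Ring ring using (-0#≈0#)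
  ⟦⟧-homo-⊝ ((p , x) ∷ f) k =
    trans (+-cong (sym (-‿distribˡ-* p (pow x k))) (⟦⟧-homo-⊝ f k)) (⁻¹-∙-comm _ _)

  ⟦⟧-homo-· : ∀ s t m → ⟦ s · t ⟧ₜ m ≈ (⟦ s ⟧ₜ ⋆ ⟦ t ⟧ₜ) m
  ⟦⟧-homo-· (p , x) (q , y) m = sym (begin
    ((λ k → p * pow x k) ⋆ (λ k → q * pow y k)) m  ≈⟨ ⋆-scaleˡ p (pow x) ⟦ q , y ⟧ₜ m ⟩
    p * (pow x ⋆ (λ k → q * pow y k)) m            ≈⟨ *-congˡ (⋆-scaleʳ q (pow x) (pow y) m) ⟩
    p * (q * (pow x ⋆ pow y) m)                    ≈⟨ *-congˡ (*-congˡ (⋆-pow x y m)) ⟩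
    p * (q * pow (x + y) m)                        ≈⟨ *-assoc _ _ _ ⟨
    p * q * pow (x + y) m                          ∎)

  ⟦⟧-homo-⊙ : ∀ t g m → ⟦ t ⊙ g ⟧ m ≈ (⟦ t ⟧ₜ ⋆ ⟦ g ⟧) m
  ⟦⟧-homo-⊙ t []      m = sym (⋆-zeroʳ ⟦ t ⟧ₜ m)
  ⟦⟧-homo-⊙ t (s ∷ g) m =
    trans (+-cong (⟦⟧-homo-· t s m) (⟦⟧-homo-⊙ t g m)) (sym (⋆-distribˡ-+ ⟦ t ⟧ₜ ⟦ s ⟧ₜ ⟦ g ⟧ m))

  ⟦⟧-homo-⊛ : ∀ f g m → ⟦ f ⊛ g ⟧ m ≈ (⟦ f ⟧ ⋆ ⟦ g ⟧) m
  ⟦⟧-homo-⊛ []      g m = sym (⋆-zeroˡ ⟦ g ⟧ m)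
  ⟦⟧-homo-⊛ (t ∷ f) g m = begin
    ⟦ t ⊙ g ++ f ⊛ g ⟧ m                   ≈⟨ ⟦⟧-homo-++ (t ⊙ g) (f ⊛ g) m ⟩
    ⟦ t ⊙ g ⟧ m + ⟦ f ⊛ g ⟧ m              ≈⟨ +-cong (⟦⟧-homo-⊙ t g m) (⟦⟧-homo-⊛ f g m) ⟩
    (⟦ t ⟧ₜ ⋆ ⟦ g ⟧) m + (⟦ f ⟧ ⋆ ⟦ g ⟧) m  ≈⟨ ⋆-distribʳ-+ ⟦ t ⟧ₜ ⟦ f ⟧ ⟦ g ⟧ m ⟨
    (⟦ t ∷ f ⟧ ⋆ ⟦ g ⟧) m                  ∎

  ⊛-distribˡ-++ : ∀ f g h → f ⊛ (g ++ h) ≋ f ⊛ g ++ f ⊛ h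
  ⊛-distribˡ-++ f g h m = begin
    ⟦ f ⊛ (g ++ h) ⟧ m                     ≈⟨ ⟦⟧-homo-⊛ f (g ++ h) m ⟩
    (⟦ f ⟧ ⋆ ⟦ g ++ h ⟧) m                 ≈⟨ ⋆-cong (λ _ → refl) (⟦⟧-homo-++ g h) m ⟩
    (⟦ f ⟧ ⋆ (λ k → ⟦ g ⟧ k + ⟦ h ⟧ k)) m  ≈⟨ ⋆-distribˡ-+ ⟦ f ⟧ ⟦ g ⟧ ⟦ h ⟧ m ⟩
    (⟦ f ⟧ ⋆ ⟦ g ⟧) m + (⟦ f ⟧ ⋆ ⟦ h ⟧) m  ≈⟨ +-cong (⟦⟧-homo-⊛ f g m) (⟦⟧-homo-⊛ f h m) ⟨
    ⟦ f ⊛ g ⟧ m + ⟦ f ⊛ h ⟧ m              ≈⟨ ⟦⟧-homo-++ (f ⊛ g) (f ⊛ h) m ⟨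
    ⟦ f ⊛ g ++ f ⊛ h ⟧ m                   ∎

  ⊛-distribʳ-++ : ∀ f g h → (f ++ g) ⊛ h ≡ f ⊛ h ++ g ⊛ h
  ⊛-distribʳ-++ []      g h = ≡.refl
  ⊛-distribʳ-++ (t ∷ f) g h =
    ≡.trans (≡.cong (t ⊙ h ++_) (⊛-distribʳ-++ f g h)) (≡.sym (++-assoc (t ⊙ h) (f ⊛ h) (g ⊛ h)))

  ⊛-zeroʳ : ∀ f → f ⊛ [] ≡ []
  ⊛-zeroʳ []      = ≡.refl
  ⊛-zeroʳ (t ∷ f) = ⊛-zeroʳ f

  ⊙≋⊛-singleton : ∀ t g → t ⊙ g ≋ g ⊛ (t ∷ [])
  ⊙≋⊛-singleton t []                  k = refl
  ⊙≋⊛-singleton (p , x) ((q , y) ∷ g) k =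
    +-cong (*-cong (*-comm p q) (pow-cong (+-comm x y) k)) (⊙≋⊛-singleton (p , x) g k)

  ⊛-comm : ∀ f g → f ⊛ g ≋ g ⊛ f
  ⊛-comm []      g k = reflexive (≡.cong (λ h → ⟦ h ⟧ k) (≡.sym (⊛-zeroʳ g)))
  ⊛-comm (t ∷ f) g k = begin
    ⟦ t ⊙ g ++ f ⊛ g ⟧ k                   ≈⟨ ⟦⟧-homo-++ (t ⊙ g) (f ⊛ g) k ⟩
    ⟦ t ⊙ g ⟧ k + ⟦ f ⊛ g ⟧ k              ≈⟨ +-cong (⊙≋⊛-singleton t g k) (⊛-comm f g k) ⟩
    ⟦ g ⊛ (t ∷ []) ⟧ k + ⟦ g ⊛ f ⟧ k       ≈⟨ ⟦⟧-homo-++ (g ⊛ (t ∷ [])) (g ⊛ f) k ⟨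
    ⟦ g ⊛ (t ∷ []) ++ g ⊛ f ⟧ k            ≈⟨ ⊛-distribˡ-++ g (t ∷ []) f k ⟨
    ⟦ g ⊛ (t ∷ f) ⟧ k                      ∎

  ·-⊙-assoc : ∀ s t h → (s · t) ⊙ h ≋ s ⊙ (t ⊙ h)
  ·-⊙-assoc s       t       []            k = refl
  ·-⊙-assoc (p , x) (q , y) ((r , z) ∷ h) k =
    +-cong (*-cong (*-assoc p q r) (pow-cong (+-assoc x y z) k)) (·-⊙-assoc (p , x) (q , y) h k)

  ⊙-⊛-assoc : ∀ t g h → (t ⊙ g) ⊛ h ≋ t ⊙ (g ⊛ h)
  ⊙-⊛-assoc t []      h k = refl
  ⊙-⊛-assoc t (s ∷ g) h k = begin
    ⟦ (t · s) ⊙ h ++ (t ⊙ g) ⊛ h ⟧ k         ≈⟨ ⟦⟧-homo-++ ((t · s) ⊙ h) ((t ⊙ g) ⊛ h) k ⟩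
    ⟦ (t · s) ⊙ h ⟧ k + ⟦ (t ⊙ g) ⊛ h ⟧ k    ≈⟨ +-cong (·-⊙-assoc t s h k) (⊙-⊛-assoc t g h k) ⟩
    ⟦ t ⊙ (s ⊙ h) ⟧ k + ⟦ t ⊙ (g ⊛ h) ⟧ k    ≈⟨ ⟦⟧-homo-++ (t ⊙ (s ⊙ h)) (t ⊙ (g ⊛ h)) k ⟨
    ⟦ t ⊙ (s ⊙ h) ++ t ⊙ (g ⊛ h) ⟧ k         ≡⟨ ≡.cong (λ e → ⟦ e ⟧ k) (map-++ (t ·_) (s ⊙ h) (g ⊛ h)) ⟨
    ⟦ t ⊙ (s ⊙ h ++ g ⊛ h) ⟧ k               ∎

  ⊛-assoc : ∀ f g h → (f ⊛ g) ⊛ h ≋ f ⊛ (g ⊛ h)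
  ⊛-assoc []      g h k = refl
  ⊛-assoc (t ∷ f) g h k = begin
    ⟦ (t ⊙ g ++ f ⊛ g) ⊛ h ⟧ k               ≡⟨ ≡.cong (λ e → ⟦ e ⟧ k) (⊛-distribʳ-++ (t ⊙ g) (f ⊛ g) h) ⟩
    ⟦ (t ⊙ g) ⊛ h ++ (f ⊛ g) ⊛ h ⟧ k         ≈⟨ ⟦⟧-homo-++ ((t ⊙ g) ⊛ h) ((f ⊛ g) ⊛ h) k ⟩
    ⟦ (t ⊙ g) ⊛ h ⟧ k + ⟦ (f ⊛ g) ⊛ h ⟧ k    ≈⟨ +-cong (⊙-⊛-assoc t g h k) (⊛-assoc f g h k) ⟩
    ⟦ t ⊙ (g ⊛ h) ⟧ k + ⟦ f ⊛ (g ⊛ h) ⟧ k    ≈⟨ ⟦⟧-homo-++ (t ⊙ (g ⊛ h)) (f ⊛ (g ⊛ h)) k ⟨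
    ⟦ t ⊙ (g ⊛ h) ++ f ⊛ (g ⊛ h) ⟧ k         ∎

  𝟙-⊙ : ∀ g → (1# , 0#) ⊙ g ≋ g
  𝟙-⊙ []            k = refl
  𝟙-⊙ ((q , y) ∷ g) k = +-cong (*-cong (*-identityˡ q) (pow-cong (+-identityˡ y) k)) (𝟙-⊙ g k)

  ⊛-identityˡ : ∀ f → 𝟙 ⊛ f ≋ f
  ⊛-identityˡ f k = trans (⟦⟧-homo-++ ((1# , 0#) ⊙ f) [] k) (trans (+-identityʳ _) (𝟙-⊙ f k))

  ++-isAbelianGroup : IsAbelianGroup _≋_ _++_ [] ⊝_
  ++-isAbelianGroup = record
    { isGroup = record
      { isMonoid = record
        { isSemigroup = record
          { isMagma = record
            { isEquivalence = record
              { refl  = λ k → refl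
              ; sym   = λ f≋g k → sym (f≋g k)
              ; trans = λ f≋g g≋h k → trans (f≋g k) (g≋h k)
              }
            ; ∙-cong = λ {f} {f′} {g} {g′} f≋f′ g≋g′ k →
                trans (⟦⟧-homo-++ f g k) (trans (+-cong (f≋f′ k) (g≋g′ k)) (sym (⟦⟧-homo-++ f′ g′ k)))
            }
          ; assoc = λ f g h k → reflexive (≡.cong (λ e → ⟦ e ⟧ k) (++-assoc f g h))
          }
        ; identity = (λ f k → refl) , (λ f k → reflexive (≡.cong (λ e → ⟦ e ⟧ k) (++-identityʳ f)))
        }
      ; inverse = (λ f k → trans (⟦⟧-homo-++ (⊝ f) f k) (trans (+-congʳ (⟦⟧-homo-⊝ f k)) (-‿inverseˡ _)))
                , (λ f k → trans (⟦⟧-homo-++ f (⊝ f) k) (trans (+-congˡ (⟦⟧-homo-⊝ f k)) (-‿inverseʳ _)))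
      ; ⁻¹-cong = λ {f} {g} f≋g k → trans (⟦⟧-homo-⊝ f k) (trans (-‿cong (f≋g k)) (sym (⟦⟧-homo-⊝ g k)))
      }
    ; comm = λ f g k → trans (⟦⟧-homo-++ f g k) (trans (+-comm _ _) (sym (⟦⟧-homo-++ g f k)))
    }

  expPolyRing : CommutativeRing c ℓ
  expPolyRing = record
    { Carrier           = ExpPoly
    ; _≈_               = _≋_
    ; _+_               = _++_
    ; _*_               = _⊛_
    ; -_                = ⊝_
    ; 0#                = []
    ; 1#                = 𝟙
    ; isCommutativeRing = record
      { isRing = record
        { +-isAbelianGroup = ++-isAbelianGroup
        ; *-cong           = λ {f} {f′} {g} {g′} f≋f′ g≋g′ k →
            trans (⟦⟧-homo-⊛ f g k) (trans (⋆-cong f≋f′ g≋g′ k) (sym (⟦⟧-homo-⊛ f′ g′ k)))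
        ; *-assoc          = ⊛-assoc
        ; *-identity       = ⊛-identityˡ , (λ f k → trans (⊛-comm f 𝟙 k) (⊛-identityˡ f k))
        ; distrib          = ⊛-distribˡ-++
                           , (λ h f g k → reflexive (≡.cong (λ e → ⟦ e ⟧ k) (⊛-distribʳ-++ f g h)))
        }
      ; *-comm = ⊛-comm
      }
    }

  ⟦⟧ₜ-cong : ∀ {p p′ x x′} → p ≈ p′ → x ≈ x′ → ∀ k → ⟦ p , x ⟧ₜ k ≈ ⟦ p′ , x′ ⟧ₜ k
  ⟦⟧ₜ-cong p≈p′ x≈x′ k = *-cong p≈p′ (pow-cong x≈x′ k)

  open Ring expPolyRing public using () renaming (ι to ι⊛)

  ⟦⟧-ι-⊛ : ∀ n f k → ⟦ ι⊛ n ⊛ f ⟧ k ≈ ι n * ⟦ f ⟧ k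
  ⟦⟧-ι-⊛ zero    f k = sym (zeroˡ _)
  ⟦⟧-ι-⊛ (suc n) f k = begin
    ⟦ (1# , 0#) ⊙ f ++ ι⊛ n ⊛ f ⟧ k       ≈⟨ ⟦⟧-homo-++ ((1# , 0#) ⊙ f) (ι⊛ n ⊛ f) k ⟩
    ⟦ (1# , 0#) ⊙ f ⟧ k + ⟦ ι⊛ n ⊛ f ⟧ k  ≈⟨ +-cong (trans (𝟙-⊙ f k) (sym (*-identityˡ _))) (⟦⟧-ι-⊛ n f k) ⟩
    1# * ⟦ f ⟧ k + ι n * ⟦ f ⟧ k          ≈⟨ distribʳ _ _ _ ⟨
    (1# + ι n) * ⟦ f ⟧ k                  ∎

module Tribonacci {c ℓ : Level} (R : CommutativeRing c ℓ) where
  open CommutativeRing R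
  open Ring R

  module Setting
    (α β γ : Carrier)
    (root-α : pow α 3 ≈ pow α 2 + α + 1#)
    (root-β : pow β 3 ≈ pow β 2 + β + 1#)
    (root-γ : pow γ 3 ≈ pow γ 2 + γ + 1#)
    (d₁ d₂ d₃ : Carrier)
    (inv₁ : ((α - β) * (α - γ)) * d₁ ≈ 1#)
    (inv₂ : ((β - α) * (β - γ)) * d₂ ≈ 1#)
    (inv₃ : ((γ - α) * (γ - β)) * d₃ ≈ 1#)
    (w : Carrier) (inv-44 : ι 44 * w ≈ 1#)
    (Ainv : ℕ → Carrier) (s : ℕ → Carrier × Carrier × Carrier)
    (binet : ∀ N → N ≥ 1 → ∀ k →
       pow (α * d₁) N * pow α k + pow (β * d₂) N * pow β k + pow (γ * d₃) N * pow γ k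
         ≈ Ainv N * T (proj₁ (s N)) (proj₁ (proj₂ (s N))) (proj₂ (proj₂ (s N))) k)
    (n : ℕ) (n≥1 : n ≥ 1)
    where

    open RingLemmas R
    open IntegerCoefficientSolver R using (solve; _:=_; _:+_; _:*_; _:-_; :-_; con)
    open Vieta R
    open BinomialConvolution R
    open ExponentialPolynomials R
    open import Relation.Binary.Reasoning.Setoid setoid
    open import Data.Nat.Properties using (≤-trans; m≤m+n)

    TT : ℕ → ℕ → Carrier
    TT N = T (proj₁ (s N)) (proj₁ (proj₂ (s N))) (proj₂ (proj₂ (s N)))

    U : ℕ → Carrier
    U = TT n

    c₁ c₂ c₃ a₁ a₂ a₃ : Carrier
    c₁ = α * d₁
    c₂ = β * d₂
    c₃ = γ * d₃
    a₁ = pow c₁ n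
    a₂ = pow c₂ n
    a₃ = pow c₃ n

    y₁ y₂ y₃ : ExpPoly
    y₁ = (a₁ , α) ∷ []
    y₂ = (a₂ , β) ∷ []
    y₃ = (a₃ , γ) ∷ []

    open CommutativeRing expPolyRing using () renaming (_+_ to _⊕_)

    S : ExpPoly
    S = y₁ ⊕ y₂ ⊕ y₃

    ⟦S⟧ : ∀ k → ⟦ S ⟧ k ≈ Ainv n * U k
    ⟦S⟧ k = trans (solve 3 (λ x y z → x :+ (y :+ (z :+ con (0 , 0))) := x :+ y :+ z) refl _ _ _)
                  (binet n n≥1 k)

    private
      monic : ∀ {x} → pow x 3 ≈ pow x 2 + x + 1# → pow x 3 ≈ 1# * pow x 2 + 1# * x + 1#
      monic root = trans root (+-congʳ (sym (+-cong (*-identityˡ _) (*-identityˡ _))))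

      module V = DistinctRoots (monic root-α) (monic root-β) (monic root-γ)
                   (unit-factorˡ inv₁) (unit-factorʳ inv₁) (unit-factorʳ inv₂)

      discriminant-44 : - discriminant 1# 1# 1# ≈ ι 44
      discriminant-44 = trans (-‿cong (discriminant-cong 1≈ι1 1≈ι1 1≈ι1)) (solve 0 (
        :- (let e = con (1 , 0) in
            e :* e :* e :* e :+ con (4 , 0) :* (e :* e :* e) :- con (4 , 0) :* (e :* e :* e :* e)
              :- con (18 , 0) :* (e :* e :* e) :- con (27 , 0) :* (e :* e))
          := con (44 , 0)) refl)
        where
        1≈ι1 : 1# ≈ ι 1
        1≈ι1 = sym (+-identityʳ 1#)

      d-product : d₁ * (d₂ * d₃) ≈ w
      d-product = begin
        d₁ * (d₂ * d₃)                    ≈⟨ *-identityʳ _ ⟨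
        d₁ * (d₂ * d₃) * 1#               ≈⟨ *-congˡ inv-44 ⟨
        d₁ * (d₂ * d₃) * (ι 44 * w)       ≈⟨ *-congˡ (*-congʳ (trans V.differences-product discriminant-44)) ⟨
        d₁ * (d₂ * d₃) * ((P₁ * (P₂ * P₃)) * w)
          ≈⟨ solve 7 (λ d₁ d₂ d₃ P₁ P₂ P₃ w →
               d₁ :* (d₂ :* d₃) :* ((P₁ :* (P₂ :* P₃)) :* w) := ((P₁ :* d₁) :* ((P₂ :* d₂) :* (P₃ :* d₃))) :* w)
               refl d₁ d₂ d₃ P₁ P₂ P₃ w ⟩
        ((P₁ * d₁) * ((P₂ * d₂) * (P₃ * d₃))) * w  ≈⟨ *-congʳ (*-cong inv₁ (*-cong inv₂ inv₃)) ⟩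
        (1# * (1# * 1#)) * w              ≈⟨ trans (*-congʳ (trans (*-identityˡ _) (*-identityˡ _))) (*-identityˡ w) ⟩
        w                                 ∎
        where
        P₁ P₂ P₃ : Carrier
        P₁ = (α - β) * (α - γ)
        P₂ = (β - α) * (β - γ)
        P₃ = (γ - α) * (γ - β)

      a-product : a₁ * (a₂ * a₃) ≈ pow w n
      a-product = begin
        a₁ * (a₂ * a₃)              ≈⟨ *-congˡ (pow-distrib-* c₂ c₃ n) ⟨
        a₁ * pow (c₂ * c₃) n        ≈⟨ pow-distrib-* c₁ (c₂ * c₃) n ⟨
        pow (c₁ * (c₂ * c₃)) n      ≈⟨ pow-cong c-product n ⟩
        pow w n                     ∎
        where
        c-product : c₁ * (c₂ * c₃) ≈ w
        c-product = begin
          (α * d₁) * ((β * d₂) * (γ * d₃))  ≈⟨ solve 6 (λ α β γ d₁ d₂ d₃ →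
                                                 (α :* d₁) :* ((β :* d₂) :* (γ :* d₃)) := (α :* β :* γ) :* (d₁ :* (d₂ :* d₃)))
                                                 refl α β γ d₁ d₂ d₃ ⟩
          (α * β * γ) * (d₁ * (d₂ * d₃))    ≈⟨ *-cong V.vieta-product d-product ⟩
          1# * w                            ≈⟨ *-identityˡ w ⟩
          w                                 ∎

    dilated : ℕ → ℕ → ExpPoly
    dilated j N = (pow c₁ N , ι j * α) ∷ (pow c₂ N , ι j * β) ∷ (pow c₃ N , ι j * γ) ∷ []

    ⟦dilated⟧ : ∀ j N → N ≥ 1 → ∀ k → ⟦ dilated j N ⟧ k ≈ pow (ι j) k * (Ainv N * TT N k)
    ⟦dilated⟧ j N N≥1 k = begin
      ⟦ dilated j N ⟧ k
        ≈⟨ +-cong (*-congˡ (pow-distrib-* (ι j) α k))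
                  (+-cong (*-congˡ (pow-distrib-* (ι j) β k)) (+-congʳ (*-congˡ (pow-distrib-* (ι j) γ k)))) ⟩
      b₁ * (p * x₁) + (b₂ * (p * x₂) + (b₃ * (p * x₃) + 0#))
        ≈⟨ solve 7 (λ p b₁ b₂ b₃ x₁ x₂ x₃ →
             b₁ :* (p :* x₁) :+ (b₂ :* (p :* x₂) :+ (b₃ :* (p :* x₃) :+ con (0 , 0)))
               := p :* (b₁ :* x₁ :+ b₂ :* x₂ :+ b₃ :* x₃)) refl p b₁ b₂ b₃ x₁ x₂ x₃ ⟩
      p * (b₁ * x₁ + b₂ * x₂ + b₃ * x₃)   ≈⟨ *-congˡ (binet N N≥1 k) ⟩
      p * (Ainv N * TT N k)               ∎
      where
      p b₁ b₂ b₃ x₁ x₂ x₃ : Carrier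
      p  = pow (ι j) k
      b₁ = pow c₁ N
      b₂ = pow c₂ N
      b₃ = pow c₃ N
      x₁ = pow α k
      x₂ = pow β k
      x₃ = pow γ k

    squares cubes product : ExpPoly
    squares = y₁ ⊛ y₁ ⊕ y₂ ⊛ y₂ ⊕ y₃ ⊛ y₃
    cubes   = y₁ ⊛ (y₁ ⊛ y₁) ⊕ y₂ ⊛ (y₂ ⊛ y₂) ⊕ y₃ ⊛ (y₃ ⊛ y₃)
    product = y₁ ⊛ (y₂ ⊛ y₃)

    squares≋dilated : squares ≋ dilated 2 (2 ℕ.* n)
    squares≋dilated k = +-cong (square c₁ α) (+-cong (square c₂ β) (+-congʳ (square c₃ γ)))
      where
      square : ∀ c x → pow c n * pow c n * pow (x + x) k ≈ pow c (2 ℕ.* n) * pow (ι 2 * x) k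
      square c x = ⟦⟧ₜ-cong (sym (pow-2* c n)) (solve 1 (λ x → x :+ x := con (2 , 0) :* x) refl x) k

    cubes≋dilated : cubes ≋ dilated 3 (3 ℕ.* n)
    cubes≋dilated k = +-cong (cube c₁ α) (+-cong (cube c₂ β) (+-congʳ (cube c₃ γ)))
      where
      cube : ∀ c x → pow c n * (pow c n * pow c n) * pow (x + (x + x)) k ≈ pow c (3 ℕ.* n) * pow (ι 3 * x) k
      cube c x = ⟦⟧ₜ-cong (sym (pow-3* c n)) (solve 1 (λ x → x :+ (x :+ x) := con (3 , 0) :* x) refl x) k

    multinomial-sum≈cube : ∀ m →
      pow (Ainv n) 3 * sumTriples m (λ k₁ k₂ k₃ → ι (multinomial3 m k₁ k₂ k₃) * (U k₁ * U k₂ * U k₃))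
        ≈ ⟦ S ⊛ (S ⊛ S) ⟧ m
    multinomial-sum≈cube m = begin
      pow (Ainv n) 3 * sumTriples m (λ k₁ k₂ k₃ → ι (multinomial3 m k₁ k₂ k₃) * (U k₁ * U k₂ * U k₃))
        ≈⟨ *-congˡ (multinomial-sum≈⋆ U U U m) ⟩
      pow (Ainv n) 3 * (U ⋆ (U ⋆ U)) m
        ≈⟨ ⋆-scale-cube (Ainv n) U m ⟨
      ((λ k → Ainv n * U k) ⋆ ((λ k → Ainv n * U k) ⋆ (λ k → Ainv n * U k))) m
        ≈⟨ ⋆-cong (λ k → sym (⟦S⟧ k)) (λ j → trans (⋆-cong (λ k → sym (⟦S⟧ k)) (λ k → sym (⟦S⟧ k)) j)
                                                  (sym (⟦⟧-homo-⊛ S S j))) m ⟩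
      (⟦ S ⟧ ⋆ ⟦ S ⊛ S ⟧) m
        ≈⟨ ⟦⟧-homo-⊛ S (S ⊛ S) m ⟨
      ⟦ S ⊛ (S ⊛ S) ⟧ m ∎

    cube-expansion : ∀ m → ⟦ S ⊛ (S ⊛ S) ⟧ m
      ≈ - (ι 2 * ⟦ cubes ⟧ m) + ι 6 * ⟦ product ⟧ m + ι 3 * ⟦ squares ⊛ S ⟧ m
    cube-expansion m = begin
      ⟦ S ⊛ (S ⊛ S) ⟧ m
        ≈⟨ CubeOfSum.cube-of-sum expPolyRing y₁ y₂ y₃ m ⟩
      ⟦ ⊝ (ι⊛ 2 ⊛ cubes) ⊕ ι⊛ 6 ⊛ product ⊕ ι⊛ 3 ⊛ (squares ⊛ S) ⟧ m
        ≈⟨ trans (⟦⟧-homo-++ (⊝ (ι⊛ 2 ⊛ cubes) ⊕ ι⊛ 6 ⊛ product) (ι⊛ 3 ⊛ (squares ⊛ S)) m)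
                 (+-congʳ (⟦⟧-homo-++ (⊝ (ι⊛ 2 ⊛ cubes)) (ι⊛ 6 ⊛ product) m)) ⟩
      ⟦ ⊝ (ι⊛ 2 ⊛ cubes) ⟧ m + ⟦ ι⊛ 6 ⊛ product ⟧ m + ⟦ ι⊛ 3 ⊛ (squares ⊛ S) ⟧ m
        ≈⟨ +-cong (+-cong (trans (⟦⟧-homo-⊝ (ι⊛ 2 ⊛ cubes) m) (-‿cong (⟦⟧-ι-⊛ 2 cubes m)))
                          (⟦⟧-ι-⊛ 6 product m))
                  (⟦⟧-ι-⊛ 3 (squares ⊛ S) m) ⟩
      - (ι 2 * ⟦ cubes ⟧ m) + ι 6 * ⟦ product ⟧ m + ι 3 * ⟦ squares ⊛ S ⟧ m ∎

    cubes-term : ∀ m → ι 2 * ⟦ cubes ⟧ m ≈ ι 2 * Ainv (3 ℕ.* n) * pow (ι 3) m * TT (3 ℕ.* n) m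
    cubes-term m = begin
      ι 2 * ⟦ cubes ⟧ m                                         ≈⟨ *-congˡ (cubes≋dilated m) ⟩
      ι 2 * ⟦ dilated 3 (3 ℕ.* n) ⟧ m                           ≈⟨ *-congˡ (⟦dilated⟧ 3 (3 ℕ.* n) 3n≥1 m) ⟩
      ι 2 * (pow (ι 3) m * (Ainv (3 ℕ.* n) * TT (3 ℕ.* n) m))
        ≈⟨ solve 3 (λ p a t → con (2 , 0) :* (p :* (a :* t)) := con (2 , 0) :* a :* p :* t) refl _ _ _ ⟩
      ι 2 * Ainv (3 ℕ.* n) * pow (ι 3) m * TT (3 ℕ.* n) m       ∎
      where
      3n≥1 : 3 ℕ.* n ≥ 1
      3n≥1 = ≤-trans n≥1 (m≤m+n n _)

    product-term : ∀ m → ι 6 * ⟦ product ⟧ m ≈ ι 6 * pow w n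
    product-term m = *-congˡ (begin
      a₁ * (a₂ * a₃) * pow (α + (β + γ)) m + 0#   ≈⟨ +-identityʳ _ ⟩
      a₁ * (a₂ * a₃) * pow (α + (β + γ)) m        ≈⟨ *-cong a-product (pow-cong roots-sum m) ⟩
      pow w n * pow 1# m                          ≈⟨ *-congˡ (pow-1# m) ⟩
      pow w n * 1#                                ≈⟨ *-identityʳ _ ⟩
      pow w n                                     ∎)
      where
      roots-sum : α + (β + γ) ≈ 1#
      roots-sum = trans (sym (+-assoc α β γ)) V.vieta-sum

    squares-term : ∀ m → ι 3 * ⟦ squares ⊛ S ⟧ m
      ≈ ι 3 * Ainv (2 ℕ.* n) * Ainv n * sumTo m (λ k → ι (m C k) * pow (ι 2) k * TT (2 ℕ.* n) k * U (m ∸ k))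
    squares-term m = begin
      ι 3 * ⟦ squares ⊛ S ⟧ m
        ≈⟨ *-congˡ (⟦⟧-homo-⊛ squares S m) ⟩
      ι 3 * (⟦ squares ⟧ ⋆ ⟦ S ⟧) m
        ≈⟨ *-congˡ (⋆-cong (λ k → trans (squares≋dilated k) (⟦dilated⟧ 2 (2 ℕ.* n) 2n≥1 k)) ⟦S⟧ m) ⟩
      ι 3 * ((λ k → pow (ι 2) k * (Ainv (2 ℕ.* n) * TT (2 ℕ.* n) k)) ⋆ (λ k → Ainv n * U k)) m
        ≈⟨ *-congˡ (sumTo-cong m (λ k _ → regroup _ _ _ _ _ _)) ⟩
      ι 3 * sumTo m (λ k → Ainv (2 ℕ.* n) * Ainv n * (ι (m C k) * pow (ι 2) k * TT (2 ℕ.* n) k * U (m ∸ k)))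
        ≈⟨ *-congˡ (*-distribˡ-sumTo m _ _) ⟨
      ι 3 * (Ainv (2 ℕ.* n) * Ainv n * sumTo m (λ k → ι (m C k) * pow (ι 2) k * TT (2 ℕ.* n) k * U (m ∸ k)))
        ≈⟨ solve 3 (λ a b x → con (3 , 0) :* (a :* b :* x) := con (3 , 0) :* a :* b :* x) refl _ _ _ ⟩
      ι 3 * Ainv (2 ℕ.* n) * Ainv n * sumTo m (λ k → ι (m C k) * pow (ι 2) k * TT (2 ℕ.* n) k * U (m ∸ k)) ∎
      where
      2n≥1 : 2 ℕ.* n ≥ 1
      2n≥1 = ≤-trans n≥1 (m≤m+n n _)
      regroup : ∀ i p a t b u → i * ((p * (a * t)) * (b * u)) ≈ a * b * (i * p * t * u)
      regroup = solve 6 (λ i p a t b u → i :* ((p :* (a :* t)) :* (b :* u)) := a :* b :* (i :* p :* t :* u)) refl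

theorem8 : {c ℓ : Level} (R : CommutativeRing c ℓ) →
  let open CommutativeRing R
      open Ring R
  in
  -- α, β, γ : roots of x³ - x² - x - 1
  (α β γ : Carrier) →
  pow α 3 ≈ pow α 2 + α + 1# →
  pow β 3 ≈ pow β 2 + β + 1# →
  pow γ 3 ≈ pow γ 2 + γ + 1# →
  -- distinctness: the denominators are invertible, with inverses d₁ d₂ d₃
  (d₁ d₂ d₃ : Carrier) →
  ((α - β) * (α - γ)) * d₁ ≈ 1# →
  ((β - α) * (β - γ)) * d₂ ≈ 1# →
  ((γ - α) * (γ - β)) * d₃ ≈ 1# →
  -- an inverse of 44 (the value 1/44 appearing in the statement)
  (w : Carrier) → ι 44 * w ≈ 1# →
  -- normalisations A₁^{(N)} (with inverse Ainv N) and s_{1,j}^{(N)}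
  (A Ainv : ℕ → Carrier) → (s : ℕ → Carrier × Carrier × Carrier) →
  (∀ N → N ≥ 1 → A N * Ainv N ≈ 1#) →
  (∀ N → N ≥ 1 → ∀ k →
      pow (α * d₁) N * pow α k + pow (β * d₂) N * pow β k + pow (γ * d₃) N * pow γ k
        ≈ Ainv N * T (proj₁ (s N)) (proj₁ (proj₂ (s N))) (proj₂ (proj₂ (s N))) k) →
  ∀ (m n : ℕ) → n ≥ 1 →
  let TT : ℕ → ℕ → Carrier
      TT N k = T (proj₁ (s N)) (proj₁ (proj₂ (s N))) (proj₂ (proj₂ (s N))) k
      U : ℕ → Carrier
      U k = TT n k
  in
  pow (Ainv n) 3 * sumTriples m (λ k₁ k₂ k₃ → ι (multinomial3 m k₁ k₂ k₃) * (U k₁ * U k₂ * U k₃))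
    ≈ - (ι 2 * Ainv (3 ℕ.* n) * pow (ι 3) m * TT (3 ℕ.* n) m)
      + ι 6 * pow w n
      + ι 3 * Ainv (2 ℕ.* n) * Ainv n
          * sumTo m (λ k → ι (m C k) * pow (ι 2) k * TT (2 ℕ.* n) k * U (m ∸ k))
-- Only the inverses Ainv N occur in the identity.
theorem8 R α β γ root-α root-β root-γ d₁ d₂ d₃ inv₁ inv₂ inv₃ w inv-44 _ Ainv s _ binet m n n≥1 = begin
  _                                                                          ≈⟨ multinomial-sum≈cube m ⟩
  ⟦ S ⊛ (S ⊛ S) ⟧ m                                                          ≈⟨ cube-expansion m ⟩
  - (ι 2 * ⟦ cubes ⟧ m) + ι 6 * ⟦ product ⟧ m + ι 3 * ⟦ squares ⊛ S ⟧ m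
    ≈⟨ +-cong (+-cong (-‿cong (cubes-term m)) (product-term m)) (squares-term m) ⟩
  _                                                                          ∎
  where
  open CommutativeRing R
  open Ring R
  open Tribonacci R
  open Setting α β γ root-α root-β root-γ d₁ d₂ d₃ inv₁ inv₂ inv₃ w inv-44 Ainv s binet n n≥1
  open ExponentialPolynomials R using (⟦_⟧; _⊛_)
  open import Relation.Binary.Reasoning.Setoid setoid
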